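{- Let $n\ge 2$ and $A=(a_1,a_2,\dots)\in\mathbb{Y}_n$. Let $\beta$ be the rotation of the regular $(n+2)$-gon sending vertex $i$ to vertex $i+1 \pmod{n+2}$, acting on triangulations diagonal-wise and on $\mathbb{Y}_n$ by $\beta A=\Lambda_{n+2}(\beta(\Lambda_{n+2}^{ -1}(A)))$. Then $\beta A$ is the Young diagram whose row lengths are the numbers $$\beta a_i=\begin{cases} a_i+1, & a_i<n-i,\\ 0, & a_i=n-i \text{ or } i>n-1,\end{cases}$$ arranged in decreasing order. Equivalently: add one square to each of the rows $1,\dots,n-1$ of $A$, discard all rows that then intersect the line $y=x-n$, and move the remaining rows up (reordering) to obtain a diagram of $\mathbb{Y}_n$.
   Context: Young diagrams are partitions $(a_1,a_2,\dots)$, $a_1\ge a_2\ge\dots\ge0$, finitely many nonzero, drawn in the fourth quadrant with row $k$ occupying $[0,a_k]\times[-k,-k+1]$; $\mathbb{Y}_n$ is the set of those with $a_k\le n-k$ for $1\le k\le n-1$ and $a_k=0$ for $k\ge n$. Vertices of a regular $(n+2)$-gon are labelled $0,\dots,n+1$ counterclockwise; $T_{n+2}$ is its set of triangulations (maximal sets of pairwise non-crossing diagonals). The tail of a diagonal is its smaller endpoint. $\Lambda_{n+2}:T_{n+2}\to\mathbb{Y}_n$ sends a triangulation to the decreasingly ordered tails of its $n-1$ diagonals padded with zeros; it is a bijection. -}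

module Defs where

open import Data.Nat using (ℕ; zero; suc; _+_; _∸_; _≤_; _<_; _<ᵇ_; _≡ᵇ_)
open import Data.Nat.Properties using (≤-decTotalOrder)
open import Data.Bool using (Bool; if_then_else_)
open import Data.List using (List; []; _∷_; map; length; reverse; replicate; _++_)
open import Data.List.Relation.Unary.All using (All)
open import Data.List.Relation.Unary.Unique.Propositional using (Unique)
open import Data.List.Membership.Propositional using (_∈_)
open import Data.Product using (_×_; _,_; proj₁)
open import Data.Sum using (_⊎_)
open import Relation.Binary.PropositionalEquality using (_≡_)
open import Relation.Nullary using (¬_)
import Data.List.Sort

-- A diagonal of the (n+2)-gon with vertices 0,…,n+1 is stored as the pair
-- (i , j) of its endpoints with i < j; the tail is i.
Diag : Set
Diag = ℕ × ℕ

IsDiagonal : ℕ → Diag → Set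
IsDiagonal n (i , j) = (suc i < j) × (j ≤ suc n) × ¬ ((i ≡ 0) × (j ≡ suc n))

Cross : Diag → Diag → Set
Cross (i , j) (k , l) = ((i < k) × (k < j) × (j < l)) ⊎ ((k < i) × (i < l) × (l < j))

IsTriangulation : ℕ → List Diag → Set
IsTriangulation n T =
  All (IsDiagonal n) T ×
  Unique T ×
  All (λ d → All (λ e → ¬ Cross d e) T) T ×
  (∀ d → IsDiagonal n d → All (λ e → ¬ Cross d e) T → d ∈ T)

tail : Diag → ℕ
tail = proj₁

sortDesc : List ℕ → List ℕ
sortDesc xs = reverse (Data.List.Sort.sort ≤-decTotalOrder xs)

-- pad with zeros to length n - 1 (rows 1,…,n-1; rows k ≥ n are zero in 𝕐ₙ)
pad : ℕ → List ℕ → List ℕ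
pad n xs = xs ++ replicate ((n ∸ 1) ∸ length xs) 0

-- Λ_{n+2}: decreasingly ordered tails, padded with zeros; a Young diagram in 𝕐ₙ
-- is represented by its list of rows a₁,…,a_{n-1}.
Λ : ℕ → List Diag → List ℕ
Λ n T = pad n (sortDesc (map tail T))

-- rotation i ↦ i+1 mod (n+2) of a diagonal, keeping the smaller endpoint first
βDiag : ℕ → Diag → Diag
βDiag n (i , j) = if j ≡ᵇ suc n then (0 , suc i) else (suc i , suc j)

βT : ℕ → List Diag → List Diag
βT n T = map (βDiag n) T

βRows : ℕ → ℕ → List ℕ → List ℕ
βRows n i [] = []
βRows n i (a ∷ as) = (if a <ᵇ (n ∸ i) then suc a else 0) ∷ βRows n (suc i) as

βYoung : ℕ → List ℕ → List ℕ
βYoung n A = pad n (sortDesc (βRows n 1 A))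

module Submission where

-- Write atLeast i for the number of diagonals of T with tail ≥ i.  The rows of
-- Λ T are the tails in decreasing order, so the diagonals with tail i fill the
-- rows atLeast (i+1) + 1, …, atLeast i.  The geometric input is a count of the
-- chords in a region [p , q] of the polygon: a non-crossing set has at most
-- q - p - 2 chords strictly inside it, and exactly that many if the region is
-- closed off by an uncrossed chord and the set is maximal in it.  For the regions
-- [i , n+1] this gives length T = n - 1, and i + atLeast i ≤ n with equality
-- exactly when (i , n+1) is a diagonal.  Rotation gives a diagonal (i , j) the tail
-- i + 1, except (i , n+1), which gets tail 0; and β discards the last row of the
-- block of tail i exactly when i + atLeast i = n.  So β on the rows of Λ T is,
-- block by block, a permutation of the rotated tails; sorting both gives the theorem.

open import Defs
open import Data.Nat using (ℕ; zero; suc; _+_; _∸_; _≤_; _≥_; _<_; _<ᵇ_; z≤n; s≤s; s≤s⁻¹; _≟_; _≤?_; _<?_)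
open import Data.Nat.Properties
  using ( ≤-refl; ≤-reflexive; ≤-trans; ≤-antisym; <-irrefl; <-trans; <-≤-trans; <-cmp; <⇒≤; <⇒≱; ≰⇒>; ≮⇒≥
        ; ≤∧≢⇒<; n≤1+n; m≤n⇒m≤1+n; m≤n⇒m<n∨m≡n; n≤0⇒n≡0; 1+n≰n; 1+n≢n; m≤m+n; m<m+n
        ; +-comm; +-assoc; +-suc; +-identityʳ; +-cancelʳ-≡; m+n≡0⇒m≡0; m+n≡0⇒n≡0
        ; +-mono-≤; +-monoˡ-≤; +-monoʳ-≤; +-monoˡ-<; m+n∸m≡n; m+n≤o⇒m≤o∸n; n∸n≡0
        ; ≤-totalOrder; ≤-decTotalOrder; module ≤-Reasoning )
open import Data.Nat.Tactic.RingSolver using (solve-∀)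
open import Data.Bool using (if_then_else_)
open import Data.List using (List; []; _∷_; _++_; length; filter; replicate; map; reverse)
open import Data.List.Properties
  using ( length-++; length-map; length-replicate; map-++; map-∘; filter-none; filter-all; filter-≐
        ; unfold-reverse; reverse-involutive; ++-identityʳ )
open import Data.List.Relation.Unary.All as All using (All; []; _∷_)
open import Data.List.Relation.Unary.All.Properties using (all-filter; replicate⁺; ++⁺; ¬Any⇒All¬)
open import Data.List.Relation.Unary.Any using (Any; here; there; any?)
open import Data.List.Relation.Unary.AllPairs using (AllPairs; []; _∷_)
import Data.List.Relation.Unary.AllPairs.Properties as AllPairs
open import Data.List.Relation.Unary.Linked.Properties using (AllPairs⇒Linked)
open import Data.List.Relation.Unary.Sorted.TotalOrder using (Sorted)
open import Data.List.Relation.Unary.Sorted.TotalOrder.Properties using (↗↭↗⇒≋)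
open import Data.List.Relation.Unary.Unique.Propositional using (Unique)
open import Data.List.Relation.Binary.Pointwise using (Pointwise-≡⇒≡)
open import Data.List.Relation.Binary.Permutation.Propositional
  using (_↭_; ↭-refl; ↭-reflexive; ↭-trans; ↭-sym; prep; ↭⇒↭ₛ′; module PermutationReasoning)
open import Data.List.Relation.Binary.Permutation.Propositional.Properties as Perm
  using (shift; ↭-length; ↭-reverse; All-resp-↭; ++⁺ˡ; map⁺)
open import Data.List.Membership.Propositional using (_∈_; _∉_; lose; find)
open import Data.List.Membership.Propositional.Properties using (∈-filter⁺; ∈-filter⁻)
open import Data.List.Extrema ≤-totalOrder using (argmax; argmax-all; f[xs]≤f[argmax])
open import Data.Product using (_×_; _,_; proj₁; proj₂; ∃)
open import Data.Product.Properties using (≡-dec)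
open import Data.Sum using (_⊎_; inj₁; inj₂; [_,_]; [_,_]′)
open import Data.Empty using (⊥; ⊥-elim)
open import Function using (flip; _∘_; case_of_)
open import Relation.Nullary using (¬_; Dec; yes; no)
open import Relation.Nullary.Decidable using (_×-dec_; _⊎-dec_; ¬?; toSum; dec-true; dec-false)
open import Relation.Unary using (Decidable)
open import Relation.Unary.Properties using (_∩?_; _∪?_; ∁?)
open import Relation.Binary.Bundles using (TotalOrder)
open import Relation.Binary.Definitions using (DecidableEquality; tri<; tri≈; tri>)
open import Relation.Binary.PropositionalEquality
  using (_≡_; _≢_; refl; sym; trans; cong; cong₂; subst; module ≡-Reasoning)

module Counting {A : Set} where

  count : {P : A → Set} → Decidable P → List A → ℕ
  count P? xs = length (filter P? xs)

  ∈⇒1≤length : ∀ {x : A} {xs} → x ∈ xs → 1 ≤ length xs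
  ∈⇒1≤length (here _)  = s≤s z≤n
  ∈⇒1≤length (there _) = s≤s z≤n

  module _ {P Q R : A → Set} (P? : Decidable P) (Q? : Decidable Q) (R? : Decidable R) where

    filter-split : ∀ xs →
      (∀ {x} → x ∈ xs → P x → Q x ⊎ R x) → (∀ {x} → x ∈ xs → Q x ⊎ R x → P x) →
      (∀ {x} → x ∈ xs → Q x → R x → ⊥) →
      filter P? xs ↭ filter Q? xs ++ filter R? xs
    filter-split [] _ _ _ = ↭-refl
    filter-split (x ∷ xs) split join disj
      with ih ← filter-split xs (λ m → split (there m)) (λ m → join (there m)) (λ m → disj (there m))
       | P? x | Q? x | R? x
    ... | _     | yes q | yes r = ⊥-elim (disj (here refl) q r)
    ... | yes _ | yes _ | no _  = prep x ih
    ... | yes _ | no _  | yes _ = ↭-trans (prep x ih) (↭-sym (shift x (filter Q? xs) (filter R? xs)))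
    ... | yes p | no ¬q | no ¬r = ⊥-elim ([ ¬q , ¬r ] (split (here refl) p))
    ... | no ¬p | yes q | no _  = ⊥-elim (¬p (join (here refl) (inj₁ q)))
    ... | no ¬p | no _  | yes r = ⊥-elim (¬p (join (here refl) (inj₂ r)))
    ... | no _  | no _  | no _  = ih

    count-split : ∀ xs →
      (∀ {x} → x ∈ xs → P x → Q x ⊎ R x) → (∀ {x} → x ∈ xs → Q x ⊎ R x → P x) →
      (∀ {x} → x ∈ xs → Q x → R x → ⊥) →
      count P? xs ≡ count Q? xs + count R? xs
    count-split xs split join disj =
      trans (↭-length (filter-split xs split join disj)) (length-++ (filter Q? xs))

  module _ {P Q : A → Set} (P? : Decidable P) (Q? : Decidable Q) where

    count-mono : ∀ xs → (∀ {x} → x ∈ xs → P x → Q x) → count P? xs ≤ count Q? xs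
    count-mono xs P⇒Q = ≤-trans (m≤m+n _ _) (≤-reflexive (sym split))
      where
        split : count Q? xs ≡ count P? xs + count (Q? ∩? ∁? P?) xs
        split = count-split Q? P? (Q? ∩? ∁? P?) xs
          (λ {x} _ q → [ inj₁ , (λ ¬p → inj₂ (q , ¬p)) ] (toSum (P? x)))
          (λ m → [ P⇒Q m , proj₁ ]) (λ _ p q¬p → proj₂ q¬p p)

  module _ {P Q R : A → Set} (P? : Decidable P) (Q? : Decidable Q) (R? : Decidable R) where

    count-cover : ∀ xs → (∀ {x} → x ∈ xs → Q x → P x ⊎ R x) →
                  count Q? xs ≤ count P? xs + count R? xs
    count-cover xs cover = ≤-trans (≤-reflexive split)
      (+-mono-≤ (count-mono (Q? ∩? P?) P? xs (λ _ → proj₂))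
                (count-mono (Q? ∩? ∁? P?) R? xs λ m (q , ¬p) → [ (λ p → ⊥-elim (¬p p)) , (λ r → r) ] (cover m q)))
      where
        split : count Q? xs ≡ count (Q? ∩? P?) xs + count (Q? ∩? ∁? P?) xs
        split = count-split Q? (Q? ∩? P?) (Q? ∩? ∁? P?) xs
          (λ {x} _ q → [ (λ p → inj₁ (q , p)) , (λ ¬p → inj₂ (q , ¬p)) ] (toSum (P? x)))
          (λ _ → [ proj₁ , proj₁ ]) (λ _ qp q¬p → proj₂ q¬p (proj₂ qp))

    count-disjoint : ∀ xs → (∀ {x} → x ∈ xs → P x → R x → ⊥) →
                     (∀ {x} → x ∈ xs → P x ⊎ R x → Q x) →
                     count P? xs + count R? xs ≤ count Q? xs
    count-disjoint xs disj join = ≤-trans (≤-reflexive (sym split)) (count-mono (P? ∪? R?) Q? xs join)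
      where
        split : count (P? ∪? R?) xs ≡ count P? xs + count R? xs
        split = count-split (P? ∪? R?) P? R? xs (λ _ pr → pr) (λ _ pr → pr) disj

  module _ {P : A → Set} (P? : Decidable P) where

    count-none : ∀ xs → (∀ {x} → x ∈ xs → ¬ P x) → count P? xs ≡ 0
    count-none xs ¬P = cong length (filter-none P? (All.tabulate ¬P))

    count-some : ∀ {x} xs → x ∈ xs → P x → 1 ≤ count P? xs
    count-some xs x∈xs px = ∈⇒1≤length (∈-filter⁺ P? x∈xs px)

  count-unique : (_≟_ : DecidableEquality A) (x : A) → ∀ {xs} → Unique xs →
                 count (_≟ x) xs ≤ 1
  count-unique _≟_ x [] = z≤n
  count-unique _≟_ x {y ∷ ys} (y∉ys ∷ u) with y ≟ x
  ... | yes refl = s≤s (≤-reflexive (count-none (_≟ y) ys (λ m y′≡y → All.lookup y∉ys m (sym y′≡y))))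
  ... | no _     = count-unique _≟_ x u

map-const : ∀ {A B : Set} (f : A → B) {c : B} {xs : List A} → All (λ x → f x ≡ c) xs →
            map f xs ≡ replicate (length xs) c
map-const f []          = refl
map-const f (fx≡c ∷ eq) = cong₂ _∷_ fx≡c (map-const f eq)

replicate-snoc : ∀ {A : Set} m (x : A) → replicate (suc m) x ≡ replicate m x ++ x ∷ []
replicate-snoc zero    x = refl
replicate-snoc (suc m) x = cong (x ∷_) (replicate-snoc m x)

AllPairs-reverse : ∀ {A : Set} {R : A → A → Set} {xs : List A} →
                   AllPairs R xs → AllPairs (flip R) (reverse xs)
AllPairs-reverse {xs = []}     []        = []
AllPairs-reverse {xs = x ∷ xs} (Rx ∷ Rs) =
  subst (AllPairs _) (sym (unfold-reverse x xs))
    (AllPairs.++⁺ (AllPairs-reverse Rs) ([] ∷ [])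
                  (All-resp-↭ (↭-sym (↭-reverse xs)) (All.map (_∷ []) Rx)))

module Sorting where

  open import Data.List.Sort ≤-decTotalOrder using (sort; sort-↭; sort-↗)

  sort-sorted : ∀ {xs ys} → Sorted ≤-totalOrder ys → xs ↭ ys → sort xs ≡ ys
  sort-sorted {xs} ys↗ xs↭ys = Pointwise-≡⇒≡ (↗↭↗⇒≋ ≤-totalOrder (sort-↗ xs) ys↗
    (↭⇒↭ₛ′ (TotalOrder.Eq.isEquivalence ≤-totalOrder) (↭-trans (sort-↭ xs) xs↭ys)))

  sortDesc-↭ : ∀ {xs ys} → xs ↭ ys → sortDesc xs ≡ sortDesc ys
  sortDesc-↭ {xs} {ys} xs↭ys =
    cong reverse (sort-sorted (sort-↗ ys) (↭-trans xs↭ys (↭-sym (sort-↭ ys))))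

  sortDesc-descending : ∀ {xs ys} → AllPairs _≥_ ys → xs ↭ ys → sortDesc xs ≡ ys
  sortDesc-descending {xs} {ys} ys↘ xs↭ys = begin
    reverse (sort xs)     ≡⟨ cong reverse (sort-sorted (AllPairs⇒Linked (AllPairs-reverse ys↘))
                                                       (↭-trans xs↭ys (↭-sym (↭-reverse ys)))) ⟩
    reverse (reverse ys)  ≡⟨ reverse-involutive ys ⟩
    ys                    ∎
    where open ≡-Reasoning

pad-full : ∀ n (xs : List ℕ) → length xs ≡ n ∸ 1 → pad n xs ≡ xs
pad-full n xs len rewrite len | n∸n≡0 (n ∸ 1) = ++-identityʳ xs

constant-descending : ∀ m {x : ℕ} → AllPairs _≥_ (replicate m x)
constant-descending zero    = []
constant-descending (suc m) = replicate⁺ m ≤-refl ∷ constant-descending m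

-- Grouping a list by a natural-number key; this is counting sort.
module Grouping {A : Set} (key : A → ℕ) (xs : List A) where

  open Counting

  group : ℕ → List A
  group i = filter (λ x → key x ≟ i) xs

  groupsDown : ℕ → List A
  groupsDown zero    = group zero
  groupsDown (suc k) = group (suc k) ++ groupsDown k

  keysDown : ℕ → List ℕ
  keysDown zero    = replicate (length (group zero)) zero
  keysDown (suc k) = replicate (length (group (suc k))) (suc k) ++ keysDown k

  groupsDown-keys : ∀ k → map key (groupsDown k) ≡ keysDown k
  groupsDown-keys zero    = map-const key (all-filter _ xs)
  groupsDown-keys (suc k) = begin
    map key (group (suc k) ++ groupsDown k)         ≡⟨ map-++ key (group (suc k)) (groupsDown k) ⟩
    map key (group (suc k)) ++ map key (groupsDown k) ≡⟨ cong₂ _++_ (map-const key (all-filter _ xs)) (groupsDown-keys k) ⟩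
    keysDown (suc k)                                ∎
    where open ≡-Reasoning

  groupsDown-↭ : ∀ k → filter (λ x → key x ≤? k) xs ↭ groupsDown k
  groupsDown-↭ zero = ↭-reflexive (filter-≐ _ _ (n≤0⇒n≡0 , ≤-reflexive) xs)
  groupsDown-↭ (suc k) = ↭-trans
    (filter-split (λ x → key x ≤? suc k) (λ x → key x ≟ suc k) (λ x → key x ≤? k) xs
      (λ _ ≤1+k → [ inj₂ ∘ s≤s⁻¹ , inj₁ ] (m≤n⇒m<n∨m≡n ≤1+k))
      (λ _ → [ ≤-reflexive , m≤n⇒m≤1+n ])
      (λ _ ≡1+k ≤k → 1+n≰n (subst (_≤ k) ≡1+k ≤k)))
    (++⁺ˡ (group (suc k)) (groupsDown-↭ k))

  keysDown-bounded : ∀ k → All (_≤ k) (keysDown k)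
  keysDown-bounded zero    = replicate⁺ _ z≤n
  keysDown-bounded (suc k) = ++⁺ (replicate⁺ _ ≤-refl) (All.map m≤n⇒m≤1+n (keysDown-bounded k))

  keysDown-descending : ∀ k → AllPairs _≥_ (keysDown k)
  keysDown-descending zero    = constant-descending _
  keysDown-descending (suc k) = AllPairs.++⁺ (constant-descending _) (keysDown-descending k)
    (replicate⁺ _ (All.map m≤n⇒m≤1+n (keysDown-bounded k)))

  grouped : ∀ k → All (λ x → key x ≤ k) xs → xs ↭ groupsDown k
  grouped k bounded = subst (_↭ groupsDown k) (filter-all _ bounded) (groupsDown-↭ k)

  keysDown-↭ : ∀ k → All (λ x → key x ≤ k) xs → map key xs ↭ keysDown k
  keysDown-↭ k bounded = subst (map key xs ↭_) (groupsDown-keys k) (map⁺ key (grouped k bounded))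

  sortDesc-keys : ∀ k → All (λ x → key x ≤ k) xs → sortDesc (map key xs) ≡ keysDown k
  sortDesc-keys k bounded = Sorting.sortDesc-descending (keysDown-descending k) (keysDown-↭ k bounded)

module RowRule (n : ℕ) where

  newRow : ℕ → ℕ → ℕ
  newRow k a = if a <ᵇ n ∸ k then suc a else 0

  newRow-grows : ∀ {k a} → k + a < n → newRow k a ≡ suc a
  newRow-grows {k} {a} k+a<n = cong (if_then suc a else 0)
    (dec-true (a <? n ∸ k) (m+n≤o⇒m≤o∸n (suc a) (subst (_≤ n) (cong suc (+-comm k a)) k+a<n)))

  newRow-vanishes : ∀ {k a} → k + a ≡ n → newRow k a ≡ 0
  newRow-vanishes {k} {a} refl = cong (if_then suc a else 0)
    (dec-false (a <? k + a ∸ k) (<-irrefl (sym (m+n∸m≡n k a))))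

  βRows-++ : ∀ k xs ys → βRows n k (xs ++ ys) ≡ βRows n k xs ++ βRows n (k + length xs) ys
  βRows-++ k []       ys = cong (λ j → βRows n j ys) (sym (+-identityʳ k))
  βRows-++ k (x ∷ xs) ys = cong (newRow k x ∷_)
    (trans (βRows-++ (suc k) xs ys) (cong (λ j → βRows n (suc k) xs ++ βRows n j ys) (sym (+-suc k (length xs)))))

  βRows-block : ∀ m k a → k + m + a ≤ n →
                βRows n k (replicate (suc m) a) ≡ replicate m (suc a) ++ newRow (k + m) a ∷ []
  βRows-block zero    k a _ = cong (λ j → newRow j a ∷ []) (sym (+-identityʳ k))
  βRows-block (suc m) k a k+m+a≤n = cong₂ _∷_ (newRow-grows first<n) (begin
    βRows n (suc k) (replicate (suc m) a)               ≡⟨ βRows-block m (suc k) a (subst (λ j → j + a ≤ n) (sym k+m≡) k+m+a≤n) ⟩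
    replicate m (suc a) ++ newRow (suc k + m) a ∷ []   ≡⟨ cong (λ j → replicate m (suc a) ++ newRow j a ∷ []) k+m≡ ⟩
    replicate m (suc a) ++ newRow (k + suc m) a ∷ []   ∎)
    where
      open ≡-Reasoning
      k+m≡ : suc k + m ≡ k + suc m
      k+m≡ = sym (+-suc k m)
      first<n : k + a < n
      first<n = <-≤-trans (+-monoˡ-< a (m<m+n k (s≤s z≤n))) k+m+a≤n

tip : Diag → ℕ
tip = proj₂

_≟ᶜ_ : DecidableEquality Diag
_≟ᶜ_ = ≡-dec _≟_ _≟_

cross? : ∀ d e → Dec (Cross d e)
cross? (i , j) (k , l) =
  ((i <? k) ×-dec ((k <? j) ×-dec (j <? l))) ⊎-dec ((k <? i) ×-dec ((i <? l) ×-dec (l <? j)))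

-- d lies in the region of the polygon spanned by the vertices p, p + 1, …, q.
Within : ℕ → ℕ → Diag → Set
Within p q d = p ≤ tail d × tip d ≤ q

within? : ∀ p q → Decidable (Within p q)
within? p q d = (p ≤? tail d) ×-dec (tip d ≤? q)

Inside : ℕ → ℕ → Diag → Set
Inside p q d = Within p q d × d ≢ (p , q)

inside? : ∀ p q → Decidable (Inside p q)
inside? p q d = within? p q d ×-dec ¬? (d ≟ᶜ (p , q))

module _ {p q p′ q′ : ℕ} (p≤p′ : p ≤ p′) (q′≤q : q′ ≤ q) where

  within-widen : ∀ {d} → Within p′ q′ d → Within p q d
  within-widen (p′≤ , ≤q′) = ≤-trans p≤p′ p′≤ , ≤-trans ≤q′ q′≤q

  within-closing : Within p′ q′ (p , q) → (p′ , q′) ≡ (p , q)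
  within-closing (p′≤p , q≤q′) = cong₂ _,_ (≤-antisym p′≤p p≤p′) (≤-antisym q′≤q q≤q′)

  within⇒inside : ∀ {d} → (p′ , q′) ≢ (p , q) → Within p′ q′ d → Inside p q d
  within⇒inside p′q′≢pq w = within-widen w , λ d≡pq → p′q′≢pq (within-closing (subst (Within p′ q′) d≡pq w))

  inside-widen : ∀ {d} → Inside p′ q′ d → Inside p q d
  inside-widen (w , d≢p′q′) =
    within-widen w , λ d≡pq → d≢p′q′ (trans d≡pq (sym (within-closing (subst (Within p′ q′) d≡pq w))))

module NonCrossing (D : List Diag) (unique : Unique D)
                   (proper : ∀ {d} → d ∈ D → suc (tail d) < tip d)
                   (noCross : ∀ {d e} → d ∈ D → e ∈ D → ¬ Cross d e) where

  open Counting

  closed : ℕ → ℕ → ℕ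
  closed p q = count (within? p q) D

  inner : ℕ → ℕ → ℕ
  inner p q = count (inside? p q) D

  closed≡inner+chord : ∀ p q → closed p q ≡ inner p q + count (_≟ᶜ (p , q)) D
  closed≡inner+chord p q = count-split (within? p q) (inside? p q) (_≟ᶜ (p , q)) D
    (λ {d} _ w → [ inj₂ , (λ d≢pq → inj₁ (w , d≢pq)) ]′ (toSum (d ≟ᶜ (p , q))))
    (λ _ → [ proj₁ , (λ { refl → ≤-refl , ≤-refl }) ])
    (λ _ inside d≡pq → proj₂ inside d≡pq)

  -- Since D has no duplicates, (p , q) adds at most one chord, exactly one if it is in D.
  closed≤1+inner : ∀ p q → closed p q ≤ suc (inner p q)
  closed≤1+inner p q = begin
    closed p q                          ≡⟨ closed≡inner+chord p q ⟩
    inner p q + count (_≟ᶜ (p , q)) D  ≤⟨ +-monoʳ-≤ (inner p q) (count-unique _≟ᶜ_ (p , q) unique) ⟩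
    inner p q + 1                       ≡⟨ +-comm (inner p q) 1 ⟩
    suc (inner p q)                     ∎
    where open ≤-Reasoning

  chord⇒inner<closed : ∀ {p q} → (p , q) ∈ D → inner p q < closed p q
  chord⇒inner<closed {p} {q} pq∈D = begin
    suc (inner p q)                     ≡⟨ +-comm 1 (inner p q) ⟩
    inner p q + 1                       ≤⟨ +-monoʳ-≤ (inner p q) (count-some (_≟ᶜ (p , q)) D pq∈D refl) ⟩
    inner p q + count (_≟ᶜ (p , q)) D  ≡⟨ closed≡inner+chord p q ⟨
    closed p q                          ∎
    where open ≤-Reasoning

  no-chord⇒closed≤inner : ∀ {p q} → (p , q) ∉ D → closed p q ≤ inner p q
  no-chord⇒closed≤inner {p} {q} pq∉D = ≤-reflexive (begin
    closed p q                          ≡⟨ closed≡inner+chord p q ⟩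
    inner p q + count (_≟ᶜ (p , q)) D  ≡⟨ cong (inner p q +_) (count-none (_≟ᶜ (p , q)) D (λ d∈D d≡pq → pq∉D (subst (_∈ D) d≡pq d∈D))) ⟩
    inner p q + 0                       ≡⟨ +-identityʳ (inner p q) ⟩
    inner p q                           ∎)
    where open ≡-Reasoning

  closed-narrow : ∀ {p q} → q ≤ suc p → closed p q ≡ 0
  closed-narrow q≤1+p = count-none (within? _ _) D
    λ d∈D (p≤t , tip≤q) → 1+n≰n (≤-trans (proper d∈D) (≤-trans tip≤q (≤-trans q≤1+p (s≤s p≤t))))

  closed≤inner : ∀ {p q p′ q′} → p ≤ p′ → q′ ≤ q → (p′ , q′) ≢ (p , q) → closed p′ q′ ≤ inner p q
  closed≤inner p≤p′ q′≤q ≢pq = count-mono (within? _ _) (inside? _ _) D (λ _ → within⇒inside p≤p′ q′≤q ≢pq)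

  closed+closed≤inner : ∀ {p b q} → p < b → b < q → closed p b + closed b q ≤ inner p q
  closed+closed≤inner {p} {b} {q} p<b b<q = count-disjoint (within? p b) (inside? p q) (within? b q) D
    (λ d∈D (_ , tip≤b) (b≤t , _) → 1+n≰n (≤-trans (proper d∈D) (≤-trans tip≤b (≤-trans b≤t (n≤1+n _)))))
    (λ _ → [ within⇒inside ≤-refl (<⇒≤ b<q) (λ eq → <-irrefl (cong tip eq) b<q)
           , within⇒inside (<⇒≤ p<b) ≤-refl (λ eq → <-irrefl (sym (cong tail eq)) p<b) ])

  LongestBelow : ℕ → ℕ → ℕ → Set
  LongestBelow p q b = (p , b) ∈ D × b < q × (∀ {e} → e ∈ D → tail e ≡ p → tip e < q → tip e ≤ b)

  longest-below : ∀ {p q d} → d ∈ D → tail d ≡ p → tip d < q → ∃ (LongestBelow p q)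
  longest-below {p} {q} {d} d∈D tail≡p tip<q = tip best , best∈D , proj₂ (proj₂ best-ok) , longest
    where
      StartsBelow : Diag → Set
      StartsBelow e = e ∈ D × tail e ≡ p × tip e < q
      candidates : List Diag
      candidates = filter (λ e → (tail e ≟ p) ×-dec (tip e <? q)) D
      best : Diag
      best = argmax tip d candidates
      best-ok : StartsBelow best
      best-ok = argmax-all tip (d∈D , tail≡p , tip<q)
        (All.tabulate λ e∈ → let e∈D , at = ∈-filter⁻ _ e∈ in e∈D , at)
      best∈D : (p , tip best) ∈ D
      best∈D = subst (λ t → (t , tip best) ∈ D) (proj₁ (proj₂ best-ok)) (proj₁ best-ok)
      longest : ∀ {e} → e ∈ D → tail e ≡ p → tip e < q → tip e ≤ tip best
      longest e∈D tail≡p tip<q = All.lookup (f[xs]≤f[argmax] d candidates) (∈-filter⁺ _ e∈D (tail≡p , tip<q))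

  split-at-longest : ∀ {p q b} → LongestBelow p q b →
                     ∀ {d} → d ∈ D → Inside p q d → Within p b d ⊎ Within b q d
  split-at-longest {p} {q} {b} (pb∈D , _ , longest) {i , j} d∈D ((p≤i , j≤q) , d≢pq)
    with j ≤? b | b ≤? i | p ≟ i
  ... | yes j≤b | _       | _      = inj₁ (p≤i , j≤b)
  ... | no _    | yes b≤i | _      = inj₂ (b≤i , j≤q)
  ... | no j≰b  | no _    | yes refl =
    ⊥-elim (j≰b (longest d∈D refl (≤∧≢⇒< j≤q λ { refl → d≢pq refl })))
  ... | no j≰b  | no b≰i  | no p≢i =
    ⊥-elim (noCross pb∈D d∈D (inj₁ (≤∧≢⇒< p≤i p≢i , ≰⇒> b≰i , ≰⇒> j≰b)))

  inside-without-fan : ∀ {p q} → ¬ Any (λ e → tail e ≡ p × tip e < q) D →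
                       ∀ {d} → d ∈ D → Inside p q d → Within (suc p) q d
  inside-without-fan {p} {q} none {i , j} d∈D ((p≤i , j≤q) , d≢pq) with p ≟ i
  ... | no p≢i   = ≤∧≢⇒< p≤i p≢i , j≤q
  ... | yes refl = ⊥-elim (none (lose d∈D (refl , ≤∧≢⇒< j≤q λ { refl → d≢pq refl })))

  Uncrossed : ℕ → ℕ → Set
  Uncrossed p q = ∀ {e} → e ∈ D → ¬ Cross e (p , q)

  Saturated : ℕ → ℕ → Set
  Saturated p q = ∀ d → suc (tail d) < tip d → Inside p q d → All (λ e → ¬ Cross d e) D → d ∈ D

  chord-uncrossed : ∀ {p q} → (p , q) ∈ D → Uncrossed p q
  chord-uncrossed pq∈D e∈D = noCross e∈D pq∈D

  saturated-shrink : ∀ {p q p′ q′} → Saturated p q → p ≤ p′ → q′ ≤ q → Saturated p′ q′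
  saturated-shrink sat p≤p′ q′≤q d proper-d inside free = sat d proper-d (inside-widen p≤p′ q′≤q inside) free

  crossing-next : ∀ {p q e} → e ∈ D → Uncrossed p q → Cross (suc p , q) e → tail e ≡ p × tip e < q
  crossing-next {e = k , l} e∈D unc (inj₁ (1+p<k , k<q , q<l)) = ⊥-elim (unc e∈D (inj₂ (<⇒≤ 1+p<k , k<q , q<l)))
  crossing-next {p} {e = k , l} e∈D unc (inj₂ (k<1+p , 1+p<l , l<q)) with k <? p
  ... | yes k<p = ⊥-elim (unc e∈D (inj₁ (k<p , <⇒≤ 1+p<l , l<q)))
  ... | no k≮p  = ≤-antisym (s≤s⁻¹ k<1+p) (≮⇒≥ k≮p) , l<q

  closing-chord-free : ∀ {p q b} → Uncrossed p q → LongestBelow p q b → All (λ e → ¬ Cross (b , q) e) D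
  closing-chord-free {p} {q} {b} unc (pb∈D , _ , longest) = All.tabulate free
    where
      p<b : p < b
      p<b = <⇒≤ (proper pb∈D)
      free : ∀ {e} → e ∈ D → ¬ Cross (b , q) e
      free {k , l} e∈D (inj₁ (b<k , k<q , q<l)) = unc e∈D (inj₂ (<-trans p<b b<k , k<q , q<l))
      free {k , l} e∈D (inj₂ (k<b , b<l , l<q)) with <-cmp k p
      ... | tri< k<p _ _ = unc e∈D (inj₁ (k<p , <-trans p<b b<l , l<q))
      ... | tri≈ _ refl _ = <⇒≱ b<l (longest e∈D refl l<q)
      ... | tri> _ _ p<k = noCross pb∈D e∈D (inj₁ (p<k , k<b , b<l))

  width-after : ∀ {k p b q} → p < b → q ≤ suc k + p → q ≤ k + b
  width-after {k} {p} p<b q≤ = ≤-trans q≤ (≤-trans (≤-reflexive (sym (+-suc k p))) (+-monoʳ-≤ k p<b))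

  closed-upper-of : ∀ {p q} → (suc p < q → suc (p + inner p q) < q) → p < q → p + closed p q < q
  closed-upper-of {p} {q} inner-bound p<q with suc p <? q
  ... | no narrow = begin-strict
    p + closed p q ≡⟨ cong (p +_) (closed-narrow (≮⇒≥ narrow)) ⟩
    p + 0          ≡⟨ +-identityʳ p ⟩
    p              <⟨ p<q ⟩
    q              ∎
    where open ≤-Reasoning
  ... | yes wide = begin-strict
    p + closed p q        ≤⟨ +-monoʳ-≤ p (closed≤1+inner p q) ⟩
    p + suc (inner p q)   ≡⟨ +-suc p (inner p q) ⟩
    suc (p + inner p q)   <⟨ inner-bound wide ⟩
    q                     ∎
    where open ≤-Reasoning

  -- Upper bound: at most q - p - 2 chords lie inside [p , q], the number of
  -- diagonals of a triangulation of the polygon p, …, q.  By induction on a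
  -- bound k for the width q - p: either no chord at p ends before q, and all
  -- chords avoid p, or the longest such chord (p , b) splits the region.
  mutual
    inner-upper : ∀ k {p q} → q ≤ k + p → suc p < q → suc (p + inner p q) < q
    inner-upper zero {p} q≤p 1+p<q = ⊥-elim (1+n≰n (≤-trans (<⇒≤ 1+p<q) q≤p))
    inner-upper (suc k) {p} {q} q≤ 1+p<q with any? (λ e → (tail e ≟ p) ×-dec (tip e <? q)) D
    ... | no none = begin-strict
      suc (p + inner p q)       ≤⟨ s≤s (+-monoʳ-≤ p (count-mono (inside? p q) (within? (suc p) q) D (inside-without-fan none))) ⟩
      suc p + closed (suc p) q  <⟨ closed-upper k (subst (q ≤_) (sym (+-suc k p)) q≤) 1+p<q ⟩
      q                         ∎
      where open ≤-Reasoning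
    ... | yes some =
      let e , e∈D , tail≡p , tip<q = find some
          b , longest@(pb∈D , b<q , _) = longest-below e∈D tail≡p tip<q
          p<b = <⇒≤ (proper pb∈D)
      in begin-strict
      suc (p + inner p q)                ≤⟨ s≤s (+-monoʳ-≤ p (count-cover (within? p b) (inside? p q) (within? b q) D (split-at-longest longest))) ⟩
      suc (p + (closed p b + closed b q)) ≡⟨ cong suc (+-assoc p (closed p b) (closed b q)) ⟨
      suc (p + closed p b) + closed b q  ≤⟨ +-monoˡ-≤ (closed b q) (closed-upper k (s≤s⁻¹ (≤-trans b<q q≤)) p<b) ⟩
      b + closed b q                     <⟨ closed-upper k (width-after p<b q≤) b<q ⟩
      q                                  ∎
      where open ≤-Reasoning

    closed-upper : ∀ k {p q} → q ≤ k + p → p < q → p + closed p q < q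
    closed-upper k q≤ = closed-upper-of (inner-upper k q≤)

  -- Lower bound on the chords inside [p , q] for a region closed off by an
  -- uncrossed chord in which D is maximal: then D triangulates the region.
  LowerBound : ℕ → ℕ → Set
  LowerBound p q = Uncrossed p q → Saturated p q → suc p < q → q ≤ 2 + (p + inner p q)

  -- If nothing crosses (p + 1 , q), that chord is in D and the bound for
  -- [p + 1 , q] carries over.
  lower-fan : ∀ {p q} → LowerBound (suc p) q → Saturated p q → 2 + p < q →
              All (λ e → ¬ Cross (suc p , q) e) D → q ≤ 2 + (p + inner p q)
  lower-fan {p} {q} bound sat 2+p<q free = begin
    q                                 ≤⟨ bound (chord-uncrossed chord∈D) (saturated-shrink sat (n≤1+n p) ≤-refl) 2+p<q ⟩
    2 + (suc p + inner (suc p) q)     ≡⟨ cong (2 +_) (+-suc p (inner (suc p) q)) ⟨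
    2 + (p + suc (inner (suc p) q))   ≤⟨ +-monoʳ-≤ 2 (+-monoʳ-≤ p (≤-trans (chord⇒inner<closed chord∈D)
                                           (closed≤inner (n≤1+n p) ≤-refl (λ eq → 1+n≢n (cong tail eq))))) ⟩
    2 + (p + inner p q)               ∎
    where
      open ≤-Reasoning
      chord∈D : (suc p , q) ∈ D
      chord∈D = sat (suc p , q) 2+p<q ((n≤1+n p , ≤-refl) , λ eq → 1+n≢n (cong tail eq)) free

  -- Otherwise the longest chord (p , b) below q, together with (b , q) when
  -- b + 1 < q, splits [p , q] into regions where the bound is known.
  lower-split : ∀ {p q b} → LowerBound p b → LowerBound b q → Uncrossed p q → Saturated p q →
                LongestBelow p q b → q ≤ 2 + (p + inner p q)
  lower-split {p} {q} {b} bound-pb bound-bq unc sat longest@(pb∈D , b<q , _) with suc b ≟ q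
  ... | yes refl = begin
    suc b                               ≤⟨ s≤s bound-left ⟩
    suc (2 + (p + inner p b))           ≡⟨ cong (2 +_) (+-suc p (inner p b)) ⟨
    2 + (p + suc (inner p b))           ≤⟨ +-monoʳ-≤ 2 (+-monoʳ-≤ p (≤-trans (chord⇒inner<closed pb∈D)
                                             (closed≤inner ≤-refl (n≤1+n b) (λ eq → 1+n≢n (sym (cong tip eq)))))) ⟩
    2 + (p + inner p (suc b))           ∎
    where open ≤-Reasoning
          bound-left : b ≤ 2 + (p + inner p b)
          bound-left = bound-pb (chord-uncrossed pb∈D) (saturated-shrink sat ≤-refl (<⇒≤ b<q)) (proper pb∈D)
  ... | no 1+b≢q = begin
    q                                                  ≤⟨ bound-bq (chord-uncrossed bq∈D) (saturated-shrink sat (<⇒≤ p<b) ≤-refl) 1+b<q ⟩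
    2 + (b + inner b q)                                ≤⟨ +-monoʳ-≤ 2 (+-monoˡ-≤ (inner b q) bound-left) ⟩
    2 + (2 + (p + inner p b) + inner b q)              ≡⟨ cong (2 +_) (regroup p (inner p b) (inner b q)) ⟩
    2 + (p + (suc (inner p b) + suc (inner b q)))      ≤⟨ +-monoʳ-≤ 2 (+-monoʳ-≤ p (+-mono-≤ (chord⇒inner<closed pb∈D) (chord⇒inner<closed bq∈D))) ⟩
    2 + (p + (closed p b + closed b q))                ≤⟨ +-monoʳ-≤ 2 (+-monoʳ-≤ p (closed+closed≤inner p<b b<q)) ⟩
    2 + (p + inner p q)                                ∎
    where
      open ≤-Reasoning
      p<b : p < b
      p<b = <⇒≤ (proper pb∈D)
      1+b<q : suc b < q
      1+b<q = ≤∧≢⇒< b<q 1+b≢q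
      bq∈D : (b , q) ∈ D
      bq∈D = sat (b , q) 1+b<q ((<⇒≤ p<b , ≤-refl) , λ eq → <-irrefl (sym (cong tail eq)) p<b) (closing-chord-free unc longest)
      bound-left : b ≤ 2 + (p + inner p b)
      bound-left = bound-pb (chord-uncrossed pb∈D) (saturated-shrink sat ≤-refl (<⇒≤ b<q)) (proper pb∈D)
      regroup : ∀ p x y → 2 + (p + x) + y ≡ p + (suc x + suc y)
      regroup = solve-∀

  -- By induction on a bound k for the width, distinguishing whether some chord
  -- crosses (p + 1 , q); such a chord starts at p by crossing-next.
  inner-lower : ∀ k {p q} → q ≤ k + p → LowerBound p q
  inner-lower zero    q≤p _ _ 1+p<q = ⊥-elim (1+n≰n (≤-trans (<⇒≤ 1+p<q) q≤p))
  inner-lower (suc k) {p} {q} q≤ unc sat 1+p<q with 2 + p ≟ q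
  ... | yes refl = s≤s (s≤s (m≤m+n p (inner p q)))
  ... | no 2+p≢q with any? (cross? (suc p , q)) D
  ...   | no free = lower-fan (inner-lower k (subst (q ≤_) (sym (+-suc k p)) q≤)) sat 2+p<q (¬Any⇒All¬ D free)
    where 2+p<q : 2 + p < q
          2+p<q = ≤∧≢⇒< 1+p<q 2+p≢q
  ...   | yes crossed =
    let e , e∈D , crosses = find crossed
        tail≡p , tip<q = crossing-next e∈D unc crosses
        b , longest@(pb∈D , b<q , _) = longest-below e∈D tail≡p tip<q
    in lower-split (inner-lower k (s≤s⁻¹ (≤-trans b<q q≤))) (inner-lower k (width-after (<⇒≤ (proper pb∈D)) q≤))
                   unc sat longest

module Triangulation (n : ℕ) (2≤n : 2 ≤ n) (T : List Diag) (tri : IsTriangulation n T) where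

  open Counting
  open RowRule n
  open import Data.List.Membership.DecPropositional _≟ᶜ_ using (_∈?_)

  diagonal : ∀ {d} → d ∈ T → IsDiagonal n d
  diagonal d∈T = All.lookup (proj₁ tri) d∈T

  proper : ∀ {d} → d ∈ T → suc (tail d) < tip d
  proper d∈T = proj₁ (diagonal d∈T)

  tip≤1+n : ∀ {d} → d ∈ T → tip d ≤ suc n
  tip≤1+n d∈T = proj₁ (proj₂ (diagonal d∈T))

  tail<n : ∀ {d} → d ∈ T → tail d < n
  tail<n d∈T = s≤s⁻¹ (≤-trans (proper d∈T) (tip≤1+n d∈T))

  noCross : ∀ {d e} → d ∈ T → e ∈ T → ¬ Cross d e
  noCross d∈T e∈T = All.lookup (All.lookup (proj₁ (proj₂ (proj₂ tri))) d∈T) e∈T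

  open NonCrossing T (proj₁ (proj₂ tri)) proper noCross

  polygon-saturated : Saturated 0 (suc n)
  polygon-saturated (i , j) proper-d ((_ , j≤1+n) , d≢side) free =
    proj₂ (proj₂ (proj₂ tri)) (i , j) (proper-d , j≤1+n , λ (i≡0 , j≡1+n) → d≢side (cong₂ _,_ i≡0 j≡1+n)) free

  polygon-uncrossed : Uncrossed 0 (suc n)
  polygon-uncrossed e∈T (inj₁ (() , _))
  polygon-uncrossed e∈T (inj₂ (_ , _ , 1+n<tip)) = <⇒≱ 1+n<tip (tip≤1+n e∈T)

  length-T : length T ≡ n ∸ 1
  length-T = cong (_∸ 1) (≤-antisym upper lower)
    where
      all-inside : inner 0 (suc n) ≡ length T
      all-inside = cong length (filter-all (inside? 0 (suc n)) (All.tabulate λ d∈T →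
        (z≤n , tip≤1+n d∈T) , λ eq → proj₂ (proj₂ (diagonal d∈T)) (cong tail eq , cong tip eq)))
      upper : suc (length T) ≤ n
      upper = s≤s⁻¹ (subst (λ c → suc (suc c) ≤ suc n) all-inside
                (inner-upper (suc n) (m≤m+n (suc n) 0) (s≤s (≤-trans (s≤s z≤n) 2≤n))))
      lower : n ≤ suc (length T)
      lower = s≤s⁻¹ (subst (λ c → suc n ≤ suc (suc c)) all-inside
                (inner-lower (suc n) (m≤m+n (suc n) 0) polygon-uncrossed polygon-saturated
                  (s≤s (≤-trans (s≤s z≤n) 2≤n))))

  -- The number of diagonals with tail at least i: the rows of length ≥ i of Λ T.
  atLeast : ℕ → ℕ
  atLeast i = count (λ d → i ≤? tail d) T

  atLeast≡closed : ∀ i → atLeast i ≡ closed i (suc n)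
  atLeast≡closed i = ≤-antisym
    (count-mono (λ d → i ≤? tail d) (within? i (suc n)) T (λ d∈T i≤ → i≤ , tip≤1+n d∈T))
    (count-mono (within? i (suc n)) (λ d → i ≤? tail d) T (λ _ → proj₁))

  atLeast-bound : ∀ {i} → i ≤ n → i + atLeast i ≤ n
  atLeast-bound {i} i≤n = s≤s⁻¹ (subst (λ c → i + c < suc n) (sym (atLeast≡closed i))
    (closed-upper (suc n) (m≤m+n (suc n) i) (s≤s i≤n)))

  atLeast-top : ∀ {i} → (i , suc n) ∈ T → i + atLeast i ≡ n
  atLeast-top {i} top∈T = ≤-antisym (atLeast-bound (<⇒≤ (tail<n top∈T))) (begin
    n                             ≤⟨ s≤s⁻¹ (inner-lower (suc n) (m≤m+n (suc n) i) (chord-uncrossed top∈T)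
                                       (saturated-shrink polygon-saturated z≤n ≤-refl) (proper top∈T)) ⟩
    suc (i + inner i (suc n))     ≡⟨ +-suc i (inner i (suc n)) ⟨
    i + suc (inner i (suc n))     ≤⟨ +-monoʳ-≤ i (chord⇒inner<closed top∈T) ⟩
    i + closed i (suc n)          ≡⟨ cong (i +_) (atLeast≡closed i) ⟨
    i + atLeast i                 ∎)
    where open ≤-Reasoning

  atLeast-no-top : ∀ {i} → (i , suc n) ∉ T → i < n → i + atLeast i < n
  atLeast-no-top {i} top∉T i<n = begin-strict
    i + atLeast i             ≡⟨ cong (i +_) (atLeast≡closed i) ⟩
    i + closed i (suc n)      ≤⟨ +-monoʳ-≤ i (no-chord⇒closed≤inner top∉T) ⟩
    i + inner i (suc n)       <⟨ s≤s⁻¹ (inner-upper (suc n) (m≤m+n (suc n) i) (s≤s i<n)) ⟩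
    n                         ∎
    where open ≤-Reasoning

  atLeast-beyond : atLeast (suc n) ≡ 0
  atLeast-beyond = count-none _ T λ d∈T 1+n≤tail → <⇒≱ (tail<n d∈T) (≤-trans (n≤1+n n) 1+n≤tail)

  open Grouping tail T

  rows : List ℕ
  rows = keysDown n

  Λ-rows : Λ n T ≡ rows
  Λ-rows = trans (cong (pad n) (sortDesc-keys n tails≤n)) (pad-full n rows rows-length)
    where
      tails≤n : All (λ d → tail d ≤ n) T
      tails≤n = All.tabulate (λ d∈T → <⇒≤ (tail<n d∈T))
      rows-length : length rows ≡ n ∸ 1
      rows-length = trans (sym (↭-length (keysDown-↭ n tails≤n))) (trans (length-map tail T) length-T)

  atLeast-split : ∀ i → atLeast i ≡ length (group i) + atLeast (suc i)
  atLeast-split i = count-split (λ d → i ≤? tail d) (λ d → tail d ≟ i) (λ d → suc i ≤? tail d) T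
    (λ _ i≤t → [ inj₂ , inj₁ ∘ sym ]′ (m≤n⇒m<n∨m≡n i≤t))
    (λ _ → [ ≤-reflexive ∘ sym , <⇒≤ ]′)
    (λ _ t≡i 1+i≤t → 1+n≰n (subst (suc i ≤_) t≡i 1+i≤t))

  occurring-tail<n : ∀ {i m} → length (group i) ≡ suc m → i < n
  occurring-tail<n {i} len with i <? n
  ... | yes i<n = i<n
  ... | no i≮n  = case trans (sym len) (count-none _ T λ d∈T t≡i → i≮n (subst (_< n) t≡i (tail<n d∈T))) of λ ()

  rotTail : Diag → ℕ
  rotTail d = tail (βDiag n d)

  rotTail-top : ∀ i → rotTail (i , suc n) ≡ 0
  rotTail-top i = cong (λ b → tail (if b then (0 , suc i) else (suc i , suc (suc n)))) (dec-true (suc n ≟ suc n) refl)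

  rotTail-other : ∀ {i j} → j ≢ suc n → rotTail (i , j) ≡ suc i
  rotTail-other {i} {j} j≢1+n = cong (λ b → tail (if b then (0 , suc i) else (suc i , suc j))) (dec-false (j ≟ suc n) j≢1+n)

  Regular : ℕ → Diag → Set
  Regular i d = tail d ≡ i × tip d ≢ suc n

  regular? : ∀ i → Decidable (Regular i)
  regular? i d = (tail d ≟ i) ×-dec ¬? (tip d ≟ suc n)

  group-split : ∀ i → group i ↭ filter (regular? i) T ++ filter (_≟ᶜ (i , suc n)) T
  group-split i = filter-split (λ d → tail d ≟ i) (regular? i) (_≟ᶜ (i , suc n)) T
    (λ {d} _ t≡i → [ (λ j≡1+n → inj₂ (cong₂ _,_ t≡i j≡1+n)) , (λ j≢1+n → inj₁ (t≡i , j≢1+n)) ]′ (toSum (tip d ≟ suc n)))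
    (λ _ → [ proj₁ , cong tail ]′)
    (λ _ (_ , j≢1+n) d≡top → j≢1+n (cong tip d≡top))

  group-length : ∀ i → length (group i) ≡ count (regular? i) T + count (_≟ᶜ (i , suc n)) T
  group-length i = trans (↭-length (group-split i)) (length-++ (filter (regular? i) T))

  group-rotation : ∀ i → map rotTail (group i) ↭
    replicate (count (regular? i) T) (suc i) ++ replicate (count (_≟ᶜ (i , suc n)) T) 0
  group-rotation i = begin
    map rotTail (group i)                                    ↭⟨ map⁺ rotTail (group-split i) ⟩
    map rotTail (filter (regular? i) T ++ filter top? T)     ≡⟨ map-++ rotTail (filter (regular? i) T) _ ⟩
    map rotTail (filter (regular? i) T) ++ map rotTail (filter top? T)
      ≡⟨ cong₂ _++_ (map-const rotTail (All.map (λ (t≡i , j≢1+n) → trans (rotTail-other j≢1+n) (cong suc t≡i))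
                                                (all-filter (regular? i) T)))
                    (map-const rotTail (All.map (λ { refl → rotTail-top i }) (all-filter top? T))) ⟩
    replicate (count (regular? i) T) (suc i) ++ replicate (count top? T) 0 ∎
    where
      open PermutationReasoning
      top? = _≟ᶜ (i , suc n)

  block-rows : ∀ {i m} → length (group i) ≡ suc m →
               βRows n (suc (atLeast (suc i))) (replicate (suc m) i) ≡ replicate m (suc i) ++ newRow (atLeast i) i ∷ []
  block-rows {i} {m} len =
    trans (βRows-block m (suc (atLeast (suc i))) i within-line)
          (cong (λ k → replicate m (suc i) ++ newRow k i ∷ []) last-row)
    where
      last-row : suc (atLeast (suc i)) + m ≡ atLeast i
      last-row = trans (cong suc (+-comm (atLeast (suc i)) m)) (sym (trans (atLeast-split i) (cong (_+ atLeast (suc i)) len)))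
      within-line : suc (atLeast (suc i)) + m + i ≤ n
      within-line = subst (λ k → k + i ≤ n) (sym last-row)
        (subst (_≤ n) (+-comm i (atLeast i)) (atLeast-bound (<⇒≤ (occurring-tail<n len))))

  last-row-rotation : ∀ {i m} → length (group i) ≡ suc m →
    replicate (count (regular? i) T) (suc i) ++ replicate (count (_≟ᶜ (i , suc n)) T) 0 ≡
    replicate m (suc i) ++ newRow (atLeast i) i ∷ []
  last-row-rotation {i} {m} len with (i , suc n) ∈? T
  ... | yes top∈T = trans (cong₂ (λ r t → replicate r (suc i) ++ replicate t 0) regular≡m top-once)
                          (cong (λ r → replicate m (suc i) ++ r ∷ []) (sym (newRow-vanishes on-line)))
    where
      top-once : count (_≟ᶜ (i , suc n)) T ≡ 1
      top-once = ≤-antisym (count-unique _≟ᶜ_ (i , suc n) (proj₁ (proj₂ tri))) (count-some _ T top∈T refl)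
      regular≡m : count (regular? i) T ≡ m
      regular≡m = +-cancelʳ-≡ 1 _ m (trans (cong (count (regular? i) T +_) (sym top-once))
                                           (trans (sym (group-length i)) (trans len (+-comm 1 m))))
      on-line : atLeast i + i ≡ n
      on-line = trans (+-comm (atLeast i) i) (atLeast-top top∈T)
  ... | no top∉T = begin
    replicate (count (regular? i) T) (suc i) ++ replicate (count (_≟ᶜ (i , suc n)) T) 0
      ≡⟨ cong₂ (λ r t → replicate r (suc i) ++ replicate t 0) regular≡1+m top-never ⟩
    replicate (suc m) (suc i) ++ []            ≡⟨ ++-identityʳ _ ⟩
    replicate (suc m) (suc i)                  ≡⟨ replicate-snoc m (suc i) ⟩
    replicate m (suc i) ++ suc i ∷ []          ≡⟨ cong (λ r → replicate m (suc i) ++ r ∷ []) (newRow-grows left-of-line) ⟨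
    replicate m (suc i) ++ newRow (atLeast i) i ∷ [] ∎
    where
      open ≡-Reasoning
      top-never : count (_≟ᶜ (i , suc n)) T ≡ 0
      top-never = count-none _ T λ d∈T d≡top → top∉T (subst (_∈ T) d≡top d∈T)
      regular≡1+m : count (regular? i) T ≡ suc m
      regular≡1+m = trans (sym (+-identityʳ _))
        (trans (cong (count (regular? i) T +_) (sym top-never)) (trans (sym (group-length i)) len))
      left-of-line : atLeast i + i < n
      left-of-line = subst (_< n) (+-comm i (atLeast i)) (atLeast-no-top top∉T (occurring-tail<n len))

  block-rotation : ∀ i → map rotTail (group i) ↭ βRows n (suc (atLeast (suc i))) (replicate (length (group i)) i)
  block-rotation i = ↭-trans (group-rotation i) (↭-reflexive rotated-block)
    where
      rotated-block : replicate (count (regular? i) T) (suc i) ++ replicate (count (_≟ᶜ (i , suc n)) T) 0 ≡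
                      βRows n (suc (atLeast (suc i))) (replicate (length (group i)) i)
      rotated-block with length (group i) in len
      ... | zero  = cong₂ (λ r t → replicate r (suc i) ++ replicate t 0)
                          (m+n≡0⇒m≡0 _ empty) (m+n≡0⇒n≡0 (count (regular? i) T) empty)
        where empty = trans (sym (group-length i)) len
      ... | suc m = trans (last-row-rotation len) (sym (block-rows len))

  rows-rotation : ∀ k → map rotTail (groupsDown k) ↭ βRows n (suc (atLeast (suc k))) (keysDown k)
  rows-rotation zero    = block-rotation zero
  rows-rotation (suc k) = begin
    map rotTail (group (suc k) ++ groupsDown k)                  ≡⟨ map-++ rotTail (group (suc k)) (groupsDown k) ⟩
    map rotTail (group (suc k)) ++ map rotTail (groupsDown k)    ↭⟨ Perm.++⁺ (block-rotation (suc k)) (rows-rotation k) ⟩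
    βRows n first-row block ++ βRows n (suc (atLeast (suc k))) (keysDown k)
      ≡⟨ cong (λ j → βRows n first-row block ++ βRows n j (keysDown k)) next-first-row ⟨
    βRows n first-row block ++ βRows n (first-row + length block) (keysDown k) ≡⟨ βRows-++ first-row block (keysDown k) ⟨
    βRows n first-row (keysDown (suc k))                              ∎
    where
      open PermutationReasoning
      first-row = suc (atLeast (suc (suc k)))
      block = replicate (length (group (suc k))) (suc k)
      next-first-row : first-row + length block ≡ suc (atLeast (suc k))
      next-first-row = cong suc (trans (cong (atLeast (suc (suc k)) +_) (length-replicate (length (group (suc k)))))
                                   (trans (+-comm _ (length (group (suc k)))) (sym (atLeast-split (suc k)))))

  rotated-tails : map tail (βT n T) ↭ βRows n 1 rows
  rotated-tails = begin
    map tail (map (βDiag n) T)                    ≡⟨ map-∘ T ⟨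
    map rotTail T                                 ↭⟨ map⁺ rotTail (grouped n (All.tabulate (λ d∈T → <⇒≤ (tail<n d∈T)))) ⟩
    map rotTail (groupsDown n)                    ↭⟨ rows-rotation n ⟩
    βRows n (suc (atLeast (suc n))) (keysDown n)  ≡⟨ cong (λ a → βRows n (suc a) (keysDown n)) atLeast-beyond ⟩
    βRows n 1 rows                                ∎
    where open PermutationReasoning

proposition3 : (n : ℕ) → 2 ≤ n → (T : List Diag) → IsTriangulation n T →
    (A : List ℕ) → Λ n T ≡ A → Λ n (βT n T) ≡ βYoung n A
proposition3 n 2≤n T tri A refl = begin
  Λ n (βT n T)                         ≡⟨ cong (pad n) (Sorting.sortDesc-↭ rotated-tails) ⟩
  pad n (sortDesc (βRows n 1 rows))    ≡⟨ cong (βYoung n) Λ-rows ⟨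
  βYoung n (Λ n T)                     ∎
  where
    open Triangulation n 2≤n T tri
    open ≡-Reasoning
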